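{- The partitions $\tau$ of $\{2,\dots,9\}$ that give a fusion of $\mathcal{A}\otimes\mathcal{A}$ for every symmetric rank $3$ standard integral table algebra basis $\mathcal{A}=\{A_0,A_1,A_2\}$ are exactly the two trivial partitions $2|3|4|5|6|7|8|9$ and $23456789$ together with the following $13$ partitions: $2|3|47|58|69$, $24|37|5|68|9$, $23|4|56|7|89$, $2|3|456|789$, $4|7|258|369$, $23|456|789$, $47|258|369$, $2|3|456789$, $23|47|5689$, $4|7|235689$, $2347|5689$, $23|456789$, $47|235689$.
   Context: A symmetric rank $3$ standard integral table algebra is a commutative associative complex algebra with basis $A_0=1,A_1,A_2$ such that the structure constants $\lambda_{ijh}$ ($A_iA_j=\sum_h\lambda_{ijh}A_h$) are nonnegative reals, $\lambda_{ij0}=0$ for $i\neq j$, and $\lambda_{ii0}=\delta(A_i)$ is a positive integer, where $\delta$ is the valency homomorphism; its character table is $[1,k,\ell;\,1,r,-1-r;\,1,s,-1-s]$ (rows the characters, columns $A_0,A_1,A_2$). Main example: $A_0=I_n$, $A_1$ the adjacency matrix of a strongly regular graph, $A_2=J-I-A_1$. The tensor square $\mathcal{A}\otimes\mathcal{A}$ has basis $A_{ij}=A_i\otimes A_j$, relabelled $C_{3j+i+1}=A_{ij}$: $C_1=A_{00},C_2=A_{10},C_3=A_{20},C_4=A_{01},C_5=A_{11},C_6=A_{21},C_7=A_{02},C_8=A_{12},C_9=A_{22}$. Partitions of $\{2,\dots,9\}$ are written with blocks separated by bars (e.g. $24|37|5|68|9$ has blocks $\{2,4\},\{3,7\},\{5\},\{6,8\},\{9\}$).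 A partition $\tau$ gives a fusion of $\mathcal{A}\otimes\mathcal{A}$ if the span of $C_1$ and the block sums $\sum_{t\in T}C_t$ ($T$ a block of $\tau$) is closed under multiplication. -}

module Defs where

open import Level using (0ℓ)
open import Algebra.Bundles using (CommutativeRing)
open import Relation.Binary.Structures using (IsTotalOrder)
open import Data.Nat using (ℕ) renaming (zero to nzero; suc to nsuc)
open import Data.Fin using (Fin; zero; suc; _≟_)
open import Data.Vec using (Vec; []; _∷_; lookup)
open import Data.Product using (_×_; _,_; ∃; proj₁; proj₂)
open import Data.List using (List; []; _∷_)
open import Data.List.Relation.Unary.Any using (Any)
open import Relation.Nullary using (¬_; does)
open import Relation.Binary.PropositionalEquality using (_≡_; _≢_)
open import Function.Bundles using (_⇔_)
open import Data.Bool using (if_then_else_)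

-- The real numbers, axiomatised as a Dedekind-complete ordered field
-- (any two such are isomorphic, so quantifying over all of them is the
-- same as working with ℝ).

record RealField : Set₁ where
  field
    commutativeRing : CommutativeRing 0ℓ 0ℓ
  open CommutativeRing commutativeRing public
    using (Carrier; _≈_; _+_; _*_; -_; 0#; 1#; isCommutativeRing)
  field
    _≤_          : Carrier → Carrier → Set
    isTotalOrder : IsTotalOrder _≈_ _≤_
    +-mono-≤     : ∀ {x y} z → x ≤ y → (x + z) ≤ (y + z)
    *-nonneg     : ∀ {x y} → 0# ≤ x → 0# ≤ y → 0# ≤ (x * y)
    0≉1          : ¬ (0# ≈ 1#)
    inverse      : ∀ x → ¬ (x ≈ 0#) → ∃ λ y → (x * y) ≈ 1#
    complete     : ∀ (P : Carrier → Set) → ∃ P → (∃ λ b → ∀ x → P x → x ≤ b) →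
                   ∃ λ s → (∀ x → P x → x ≤ s) × (∀ b → (∀ x → P x → x ≤ b) → s ≤ b)

module _ (F : RealField) where
  open RealField F

  ι : ℕ → Carrier
  ι nzero    = 0#
  ι (nsuc n) = 1# + ι n

  kron : ∀ {n} → Fin n → Fin n → Carrier
  kron i j = if does (i ≟ j) then 1# else 0#

  Σ3 : (Fin 3 → Carrier) → Carrier
  Σ3 f = f zero + (f (suc zero) + f (suc (suc zero)))

  Σ9 : (Fin 9 → Carrier) → Carrier
  Σ9 f = f zero + Σ8 (λ k → f (suc k))
    where
    Σ8 : (Fin 8 → Carrier) → Carrier
    Σ8 g = g zero + (g (suc zero) + (g (suc (suc zero)) + (g (suc (suc (suc zero)))
         + (g (suc (suc (suc (suc zero)))) + (g (suc (suc (suc (suc (suc zero)))))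
         + (g (suc (suc (suc (suc (suc (suc zero)))))) + g (suc (suc (suc (suc (suc (suc (suc zero)))))))))))))

-- Symmetric rank 3 standard integral table algebra, given by its
-- structure constants  A_i A_j = Σ_h c i j h A_h  (basis A_0 = 1, A_1, A_2).

record TableAlgebra (F : RealField) : Set where
  open RealField F
  field
    c        : Fin 3 → Fin 3 → Fin 3 → Carrier
    unit     : ∀ j h → c zero j h ≈ kron F j h
    comm     : ∀ i j h → c i j h ≈ c j i h
    assoc    : ∀ i j h t → Σ3 F (λ m → c i j m * c m h t) ≈ Σ3 F (λ m → c j h m * c i m t)
    nonneg   : ∀ i j h → 0# ≤ c i j h
    off-diag : ∀ i j → i ≢ j → c i j zero ≈ 0#
    valency-int : ∀ i → ∃ λ n → c i i zero ≈ ι F (nsuc n)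
    valency-hom : ∀ i j → (c i i zero * c j j zero) ≈ Σ3 F (λ h → c i j h * c h h zero)

  δ : Fin 3 → Carrier
  δ i = c i i zero

-- The tensor square, basis C_1..C_9 indexed 0..8 (C_{3j+i+1} = A_i ⊗ A_j).

tensorIdx : Fin 9 → Fin 3 × Fin 3
tensorIdx a = lookup table a
  where
  f0 f1 f2 : Fin 3
  f0 = zero
  f1 = suc zero
  f2 = suc (suc zero)
  table : Vec (Fin 3 × Fin 3) 9
  table = (f0 , f0) ∷ (f1 , f0) ∷ (f2 , f0) ∷ (f0 , f1) ∷ (f1 , f1) ∷ (f2 , f1)
        ∷ (f0 , f2) ∷ (f1 , f2) ∷ (f2 , f2) ∷ []

tc : ∀ {F} → TableAlgebra F → Fin 9 → Fin 9 → Fin 9 → RealField.Carrier F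
tc {F} A a b e =
  c (proj₁ (tensorIdx a)) (proj₁ (tensorIdx b)) (proj₁ (tensorIdx e))
  * c (proj₂ (tensorIdx a)) (proj₂ (tensorIdx b)) (proj₂ (tensorIdx e))
  where open RealField F ; open TableAlgebra A

-- Partitions of {2,…,9}: given by a block-labelling τ : Fin 8 → Fin 8,
-- where Fin 8 index k stands for C_{k+2}; two elements are in the same
-- block iff they have the same label.

Partition : Set
Partition = Fin 8 → Fin 8

label : Partition → Fin 9 → Fin 9
label τ zero    = zero
label τ (suc k) = suc (τ k)

module _ {F : RealField} (A : TableAlgebra F) (τ : Partition) where
  open RealField F

  -- coordinate vector (w.r.t. C_1..C_9) of the block sum containing a
  blockSum : Fin 9 → Fin 9 → Carrier
  blockSum a e = if does (label τ e ≟ label τ a) then 1# else 0#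

  mul : (Fin 9 → Carrier) → (Fin 9 → Carrier) → Fin 9 → Carrier
  mul x y e = Σ9 F (λ a → Σ9 F (λ b → (x a * y b) * tc A a b e))

  -- v lies in the span of C_1 and the block sums of τ
  -- (= Σ over labels l of w l times the sum of the C_e with label l)
  InSpan : (Fin 9 → Carrier) → Set
  InSpan v = ∃ λ (w : Fin 9 → Carrier) → ∀ e → v e ≈ w (label τ e)

  -- τ gives a fusion: the span is closed under multiplication
  -- (it suffices/amounts to: products of spanning elements lie in the span)
  GivesFusion : Set
  GivesFusion = ∀ a b → InSpan (mul (blockSum a) (blockSum b))

-- The 15 listed partitions, as labellings of C_1..C_9 (C_1 labelled 0,
-- every other block labelled by its least element).

listed : List (Vec ℕ 9)
listed =
    (0 ∷ 2 ∷ 3 ∷ 4 ∷ 5 ∷ 6 ∷ 7 ∷ 8 ∷ 9 ∷ [])   -- 2|3|4|5|6|7|8|9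
  ∷ (0 ∷ 2 ∷ 2 ∷ 2 ∷ 2 ∷ 2 ∷ 2 ∷ 2 ∷ 2 ∷ [])   -- 23456789
  ∷ (0 ∷ 2 ∷ 3 ∷ 4 ∷ 5 ∷ 6 ∷ 4 ∷ 5 ∷ 6 ∷ [])   -- 2|3|47|58|69
  ∷ (0 ∷ 2 ∷ 3 ∷ 2 ∷ 5 ∷ 6 ∷ 3 ∷ 6 ∷ 9 ∷ [])   -- 24|37|5|68|9
  ∷ (0 ∷ 2 ∷ 2 ∷ 4 ∷ 5 ∷ 5 ∷ 7 ∷ 8 ∷ 8 ∷ [])   -- 23|4|56|7|89
  ∷ (0 ∷ 2 ∷ 3 ∷ 4 ∷ 4 ∷ 4 ∷ 7 ∷ 7 ∷ 7 ∷ [])   -- 2|3|456|789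
  ∷ (0 ∷ 2 ∷ 3 ∷ 4 ∷ 2 ∷ 3 ∷ 7 ∷ 2 ∷ 3 ∷ [])   -- 4|7|258|369
  ∷ (0 ∷ 2 ∷ 2 ∷ 4 ∷ 4 ∷ 4 ∷ 7 ∷ 7 ∷ 7 ∷ [])   -- 23|456|789
  ∷ (0 ∷ 2 ∷ 3 ∷ 4 ∷ 2 ∷ 3 ∷ 4 ∷ 2 ∷ 3 ∷ [])   -- 47|258|369
  ∷ (0 ∷ 2 ∷ 3 ∷ 4 ∷ 4 ∷ 4 ∷ 4 ∷ 4 ∷ 4 ∷ [])   -- 2|3|456789
  ∷ (0 ∷ 2 ∷ 2 ∷ 4 ∷ 5 ∷ 5 ∷ 4 ∷ 5 ∷ 5 ∷ [])   -- 23|47|5689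
  ∷ (0 ∷ 2 ∷ 2 ∷ 4 ∷ 2 ∷ 2 ∷ 7 ∷ 2 ∷ 2 ∷ [])   -- 4|7|235689
  ∷ (0 ∷ 2 ∷ 2 ∷ 2 ∷ 5 ∷ 5 ∷ 2 ∷ 5 ∷ 5 ∷ [])   -- 2347|5689
  ∷ (0 ∷ 2 ∷ 2 ∷ 4 ∷ 4 ∷ 4 ∷ 4 ∷ 4 ∷ 4 ∷ [])   -- 23|456789
  ∷ (0 ∷ 2 ∷ 2 ∷ 4 ∷ 2 ∷ 2 ∷ 4 ∷ 2 ∷ 2 ∷ [])   -- 47|235689
  ∷ []

SamePartition : Partition → Vec ℕ 9 → Set
SamePartition τ π = ∀ a b → (label τ a ≡ label τ b) ⇔ (lookup π a ≡ lookup π b)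

IsListed : Partition → Set
IsListed τ = Any (SamePartition τ) listed

{-# OPTIONS --safe #-}

-- A partition is determined by its leader vector (each C_{k+2} labelled by the least element
-- of its block), so only 4140 partitions have to be inspected.  The Petersen graph algebra
-- (k = 3, λ = 0, μ = 1) is a standard integral table algebra, and three products in its tensor
-- square, A₂₁A₂₁, A₀₂A₁₂ and A₁₀A₁₁, fail to lie in the span of the block sums for every
-- partition outside the list.  Conversely, comparing coefficients of A₀ in the associativity
-- law and using the valency homomorphism shows that every structure constant λ_{ijh} is an
-- integer polynomial in δ(A₁), δ(A₂), λ₁₂₁ and λ₁₂₂; for a listed partition, closure under
-- multiplication thus becomes finitely many polynomial identities, checked by normalisation.

module Submission where

open import Level using (Level)
open import Defs
open import Algebra.Bundles using (CommutativeRing)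
open import Data.Bool using (Bool; true; false; if_then_else_; T)
open import Data.Empty using (⊥-elim)
open import Data.Fin as Fin using (Fin; zero; suc; toℕ)
import Data.Fin.Properties as Fin
open import Data.Nat as ℕ using (ℕ; zero; suc)
import Data.Nat.Properties as ℕ
open import Data.Integer as ℤ using (ℤ; +_; -[1+_]; _⊖_)
import Data.Integer.Properties as ℤ
open import Data.Sign as Sign using (Sign)
open import Data.List using (List; []; _∷_)
open import Data.List.Relation.Unary.All as All using (All)
open import Data.List.Relation.Unary.Any as Any using (here; there)
open import Data.Maybe using (Maybe; just; nothing; is-just)
open import Data.Product using (_×_; _,_; proj₁; proj₂; ∃)
open import Data.Sum using (_⊎_; inj₁; inj₂)
open import Data.Vec as Vec using (Vec; []; _∷_; tabulate; foldr₁; lookup)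
import Data.Vec.Properties as Vecₚ
open import Data.List.Membership.DecPropositional (Vecₚ.≡-dec {n = 9} ℕ._≟_) using (_∈?_)
open import Data.List.Membership.Propositional using (_∈_)
open import Function using (_∘_)
open import Function.Bundles using (_⇔_; mk⇔; Equivalence)
open import Relation.Binary.Definitions using (DecidableEquality; tri<; tri≈; tri>)
open import Relation.Binary.PropositionalEquality as ≡ using (_≡_; _≢_)
open import Relation.Binary.Structures using (IsTotalOrder)
open import Relation.Nullary using (¬_; Dec; does; yes; no)
open import Relation.Nullary.Decidable using (from-yes; does-⇔; ¬?; _→-dec_; T?)
import Algebra.Properties.Ring as RingProperties
import Algebra.Properties.Group as GroupProperties
import Algebra.Properties.Semiring.Mult as SemiringMult
import Algebra.Solver.Ring
import Algebra.Solver.Ring.NaturalCoefficients.Default as NaturalSolver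
open import Algebra.Solver.Ring.AlmostCommutativeRing
  using (fromCommutativeRing; _-Raw-AlmostCommutative⟶_)

module IntegerCoefficients {c ℓ : Level} (R : CommutativeRing c ℓ) where
  open CommutativeRing R hiding (zero)
  open RingProperties ring using (-1*x≈-x; -0#≈0#; -‿involutive; -‿+-comm)
  open SemiringMult semiring using (×-homo-+; ×1-homo-*) renaming (_×_ to _·_)
  open NaturalSolver commutativeSemiring using (solve; _:=_; _:+_; _:*_)
  open import Relation.Binary.Reasoning.Setoid setoid

  ⟦_⟧ℤ : ℤ → Carrier
  ⟦ + n ⟧ℤ      = n · 1#
  ⟦ -[1+ n ] ⟧ℤ = - (suc n · 1#)

  ⊖-homo : ∀ m n → ⟦ m ⊖ n ⟧ℤ ≈ m · 1# - n · 1#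
  ⊖-homo m zero = begin
    ⟦ m ⊖ 0 ⟧ℤ    ≡⟨ ≡.cong ⟦_⟧ℤ (ℤ.⊖-≥ {m} ℕ.z≤n) ⟩
    m · 1#        ≈⟨ sym (+-identityʳ _) ⟩
    m · 1# + 0#   ≈⟨ +-congˡ (sym -0#≈0#) ⟩
    m · 1# - 0#   ∎
  ⊖-homo zero (suc n) = begin
    ⟦ 0 ⊖ suc n ⟧ℤ     ≡⟨ ≡.cong ⟦_⟧ℤ (ℤ.⊖-< {0} {suc n} (ℕ.s≤s ℕ.z≤n)) ⟩
    - (suc n · 1#)      ≈⟨ sym (+-identityˡ _) ⟩
    0# - suc n · 1#     ∎
  ⊖-homo (suc m) (suc n) = begin
    ⟦ suc m ⊖ suc n ⟧ℤ             ≡⟨ ≡.cong ⟦_⟧ℤ (ℤ.[1+m]⊖[1+n]≡m⊖n m n) ⟩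
    ⟦ m ⊖ n ⟧ℤ                     ≈⟨ ⊖-homo m n ⟩
    m · 1# - n · 1#                ≈⟨ sym (+-congʳ (+-identityˡ _)) ⟩
    (0# + m · 1#) - n · 1#         ≈⟨ +-congʳ (+-congʳ (sym (-‿inverseʳ 1#))) ⟩
    (1# - 1# + m · 1#) - n · 1#
      ≈⟨ solve 4 (λ a b x y → (a :+ b :+ x) :+ y := (a :+ x) :+ (b :+ y)) refl 1# (- 1#) _ _ ⟩
    (1# + m · 1#) + (- 1# - n · 1#) ≈⟨ +-congˡ (-‿+-comm 1# _) ⟩
    suc m · 1# - suc n · 1#         ∎

  +-homo : ∀ i j → ⟦ i ℤ.+ j ⟧ℤ ≈ ⟦ i ⟧ℤ + ⟦ j ⟧ℤ
  +-homo -[1+ m ] -[1+ n ] = begin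
    - (suc (suc (m ℕ.+ n)) · 1#)            ≈⟨ -‿cong (+-congˡ (+-congˡ (×-homo-+ 1# m n))) ⟩
    - (1# + (1# + (m · 1# + n · 1#)))
      ≈⟨ -‿cong (solve 3 (λ o a b → o :+ (o :+ (a :+ b)) := (o :+ a) :+ (o :+ b)) refl 1# _ _) ⟩
    - (suc m · 1# + suc n · 1#)             ≈⟨ sym (-‿+-comm _ _) ⟩
    - (suc m · 1#) - suc n · 1#             ∎
  +-homo -[1+ m ] (+ n)    = trans (⊖-homo n (suc m)) (+-comm _ _)
  +-homo (+ m)    -[1+ n ] = ⊖-homo m (suc n)
  +-homo (+ m)    (+ n)    = ×-homo-+ 1# m n

  -‿homo : ∀ i → ⟦ ℤ.- i ⟧ℤ ≈ - ⟦ i ⟧ℤ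
  -‿homo (+ zero)  = sym -0#≈0#
  -‿homo (+ suc n) = refl
  -‿homo -[1+ n ]  = sym (-‿involutive _)

  private
    ⟦_⟧± : Sign → Carrier
    ⟦ Sign.+ ⟧± = 1#
    ⟦ Sign.- ⟧± = - 1#

    sign-homo : ∀ s t → ⟦ s Sign.* t ⟧± ≈ ⟦ s ⟧± * ⟦ t ⟧±
    sign-homo Sign.+ t      = sym (*-identityˡ _)
    sign-homo Sign.- Sign.+ = sym (*-identityʳ _)
    sign-homo Sign.- Sign.- = sym (trans (-1*x≈-x (- 1#)) (-‿involutive 1#))

    ◃-homo : ∀ s n → ⟦ s ℤ.◃ n ⟧ℤ ≈ ⟦ s ⟧± * n · 1#
    ◃-homo s      zero    = sym (zeroʳ _)
    ◃-homo Sign.+ (suc n) = sym (*-identityˡ _)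
    ◃-homo Sign.- (suc n) = sym (-1*x≈-x _)

    sign-abs : ∀ i → ⟦ i ⟧ℤ ≈ ⟦ ℤ.sign i ⟧± * ℤ.∣ i ∣ · 1#
    sign-abs i = trans (reflexive (≡.cong ⟦_⟧ℤ (≡.sym (ℤ.◃-inverse i)))) (◃-homo (ℤ.sign i) ℤ.∣ i ∣)

  *-homo : ∀ i j → ⟦ i ℤ.* j ⟧ℤ ≈ ⟦ i ⟧ℤ * ⟦ j ⟧ℤ
  *-homo i j = begin
    ⟦ i ℤ.* j ⟧ℤ                                 ≈⟨ ◃-homo (s Sign.* t) (m ℕ.* n) ⟩
    ⟦ s Sign.* t ⟧± * (m ℕ.* n) · 1#             ≈⟨ *-cong (sign-homo s t) (×1-homo-* m n) ⟩
    (⟦ s ⟧± * ⟦ t ⟧±) * (m · 1# * n · 1#)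
      ≈⟨ solve 4 (λ a b x y → (a :* b) :* (x :* y) := (a :* x) :* (b :* y)) refl _ _ _ _ ⟩
    (⟦ s ⟧± * m · 1#) * (⟦ t ⟧± * n · 1#)        ≈⟨ sym (*-cong (sign-abs i) (sign-abs j)) ⟩
    ⟦ i ⟧ℤ * ⟦ j ⟧ℤ                              ∎
    where s = ℤ.sign i ; t = ℤ.sign j ; m = ℤ.∣ i ∣ ; n = ℤ.∣ j ∣

  ℤ-morphism : ℤ.+-*-rawRing -Raw-AlmostCommutative⟶ fromCommutativeRing R
  ℤ-morphism = record
    { ⟦_⟧ = ⟦_⟧ℤ ; +-homo = +-homo ; *-homo = *-homo ; -‿homo = -‿homo
    ; 0-homo = refl ; 1-homo = +-identityʳ 1# }

  ⟦⟧ℤ-≟ : ∀ i j → Maybe (⟦ i ⟧ℤ ≈ ⟦ j ⟧ℤ)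
  ⟦⟧ℤ-≟ i j with i ℤ.≟ j
  ... | yes ≡.refl = just refl
  ... | no _       = nothing

  open Algebra.Solver.Ring ℤ.+-*-rawRing (fromCommutativeRing R) ℤ-morphism ⟦⟧ℤ-≟ public

∑ : ∀ {a} {A : Set a} {n} → (A → A → A) → (Fin (suc n) → A) → A
∑ _⊕_ f = foldr₁ _⊕_ (tabulate f)

module SumProperties {c ℓ : Level} (R : CommutativeRing c ℓ) where
  open CommutativeRing R hiding (zero)

  ∑-cong : ∀ {n} {f g : Fin (suc n) → Carrier} → (∀ i → f i ≈ g i) → ∑ _+_ f ≈ ∑ _+_ g
  ∑-cong {zero}  f≈g = f≈g zero
  ∑-cong {suc n} f≈g = +-cong (f≈g zero) (∑-cong (f≈g ∘ suc))

  ∑-zero : ∀ {n} → ∑ {n = n} _+_ (λ _ → 0#) ≈ 0#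
  ∑-zero {zero}  = refl
  ∑-zero {suc n} = trans (+-identityˡ _) (∑-zero {n})

  ∑-single : ∀ {n} (f : Fin (suc n) → Carrier) h → (∀ i → i ≢ h → f i ≈ 0#) → ∑ _+_ f ≈ f h
  ∑-single {zero}  f zero    _   = refl
  ∑-single {suc n} f zero    off =
    trans (+-congˡ (trans (∑-cong (λ i → off (suc i) λ ())) (∑-zero {n}))) (+-identityʳ _)
  ∑-single {suc n} f (suc h) off =
    trans (+-congʳ (off zero λ ())) (trans (+-identityˡ _)
      (∑-single (f ∘ suc) h (λ i i≢h → off (suc i) (i≢h ∘ Fin.suc-injective))))

  ∑-distribʳ : ∀ {n} (f : Fin (suc n) → Carrier) x → ∑ _+_ f * x ≈ ∑ _+_ (λ i → f i * x)
  ∑-distribʳ {zero}  f x = refl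
  ∑-distribʳ {suc n} f x = trans (distribʳ x _ _) (+-congˡ (∑-distribʳ (f ∘ suc) x))

  ∑-homo : ∀ {a} {A : Set a} {n} (_⊕_ : A → A → A) (h : A → Carrier) →
           (∀ x y → h (x ⊕ y) ≈ h x + h y) → (f : Fin (suc n) → A) → h (∑ _⊕_ f) ≈ ∑ _+_ (h ∘ f)
  ∑-homo {n = zero}  _⊕_ h homo f = refl
  ∑-homo {n = suc n} _⊕_ h homo f = trans (homo _ _) (+-congˡ (∑-homo _⊕_ h homo (f ∘ suc)))


module RealFieldProperties (F : RealField) where
  open RealField F
  open CommutativeRing commutativeRing hiding (zero; _+_; _*_; -_; 0#; 1#; Carrier; _≈_)
  open IsTotalOrder isTotalOrder using (total; antisym) renaming (reflexive to ≤-reflexive; trans to ≤-trans)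
  open RingProperties ring using (-1*x≈-x; -‿involutive)
  open GroupProperties +-group using (identityʳ-unique)
  open SemiringMult semiring using (×-homo-+; ×1-homo-*) renaming (_×_ to _·_)
  open import Relation.Binary.Reasoning.Setoid setoid

  ι≡×1 : ∀ n → ι F n ≡ n · 1#
  ι≡×1 zero    = ≡.refl
  ι≡×1 (suc n) = ≡.cong (_+_ 1#) (ι≡×1 n)

  ι-+ : ∀ m n → ι F (m ℕ.+ n) ≈ ι F m + ι F n
  ι-+ m n rewrite ι≡×1 (m ℕ.+ n) | ι≡×1 m | ι≡×1 n = ×-homo-+ 1# m n

  ι-* : ∀ m n → ι F (m ℕ.* n) ≈ ι F m * ι F n
  ι-* m n rewrite ι≡×1 (m ℕ.* n) | ι≡×1 m | ι≡×1 n = ×1-homo-* m n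

  private
    ≤-respˡ : ∀ {x y z} → x ≈ y → x ≤ z → y ≤ z
    ≤-respˡ x≈y x≤z = ≤-trans (≤-reflexive (sym x≈y)) x≤z

    ≤-respʳ : ∀ {x y z} → y ≈ z → x ≤ y → x ≤ z
    ≤-respʳ y≈z x≤y = ≤-trans x≤y (≤-reflexive y≈z)

  -- squares are nonnegative, and 1 = (-1)(-1)
  0≤1 : 0# ≤ 1#
  0≤1 with total 0# 1#
  ... | inj₁ 0≤1 = 0≤1
  ... | inj₂ 1≤0 = ≤-respʳ (trans (-1*x≈-x (- 1#)) (-‿involutive 1#)) (*-nonneg 0≤-1 0≤-1)
    where
    0≤-1 : 0# ≤ (- 1#)
    0≤-1 = ≤-respˡ (-‿inverseʳ 1#) (≤-respʳ (+-identityˡ (- 1#)) (+-mono-≤ (- 1#) 1≤0))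

  0≤ι : ∀ n → 0# ≤ ι F n
  1≤ι-suc : ∀ n → 1# ≤ ι F (suc n)

  0≤ι zero    = ≤-reflexive refl
  0≤ι (suc n) = ≤-trans 0≤1 (1≤ι-suc n)

  1≤ι-suc n = ≤-respˡ (+-identityˡ 1#) (≤-respʳ (+-comm (ι F n) 1#) (+-mono-≤ 1# (0≤ι n)))

  ι-suc≉0 : ∀ n → ¬ (ι F (suc n) ≈ 0#)
  ι-suc≉0 n eq = 0≉1 (antisym 0≤1 (≤-respʳ eq (1≤ι-suc n)))

  private
    ι-<⇒≉ : ∀ {m n} → m ℕ.< n → ¬ (ι F m ≈ ι F n)
    ι-<⇒≉ {m} {n} m<n eq with ℕ.m≤n⇒∃[o]m+o≡n m<n
    ... | o , suc[m+o]≡n = ι-suc≉0 o (identityʳ-unique (ι F m) (ι F (suc o)) (begin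
      ι F m + ι F (suc o)  ≈⟨ ι-+ m (suc o) ⟨
      ι F (m ℕ.+ suc o)    ≡⟨ ≡.cong (ι F) (≡.trans (ℕ.+-suc m o) suc[m+o]≡n) ⟩
      ι F n                ≈⟨ eq ⟨
      ι F m                ∎))

  ι-injective : ∀ {m n} → ι F m ≈ ι F n → m ≡ n
  ι-injective {m} {n} eq with ℕ.<-cmp m n
  ... | tri< m<n _ _ = ⊥-elim (ι-<⇒≉ m<n eq)
  ... | tri≈ _ m≡n _ = m≡n
  ... | tri> _ _ n<m = ⊥-elim (ι-<⇒≉ n<m (sym eq))

  *-cancelʳ : ∀ {x y d} → ¬ (d ≈ 0#) → x * d ≈ y * d → x ≈ y
  *-cancelʳ {x} {y} {d} d≉0 xd≈yd with inverse d d≉0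
  ... | d⁻¹ , dd⁻¹≈1 = begin
    x               ≈⟨ *-identityʳ x ⟨
    x * 1#          ≈⟨ *-congˡ dd⁻¹≈1 ⟨
    x * (d * d⁻¹)   ≈⟨ *-assoc x d d⁻¹ ⟨
    x * d * d⁻¹     ≈⟨ *-congʳ xd≈yd ⟩
    y * d * d⁻¹     ≈⟨ *-assoc y d d⁻¹ ⟩
    y * (d * d⁻¹)   ≈⟨ *-congˡ dd⁻¹≈1 ⟩
    y * 1#          ≈⟨ *-identityʳ y ⟩
    y               ∎

module _ {A : Set} (_≟_ : DecidableEquality A) where

  firstIndex : ∀ {n} → (Fin (suc n) → A) → A → Fin (suc n)
  firstIndex {zero}  f a = zero
  firstIndex {suc n} f a = if does (f zero ≟ a) then zero else suc (firstIndex (f ∘ suc) a)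

  firstIndex-sound : ∀ {n} (f : Fin (suc n) → A) {i} → f (firstIndex f (f i)) ≡ f i
  firstIndex-sound {zero}  f {zero} = ≡.refl
  firstIndex-sound {suc n} f {i} with f zero ≟ f i
  ... | yes f0≡fi = f0≡fi
  firstIndex-sound {suc n} f {zero}  | no f0≢f0 = ⊥-elim (f0≢f0 ≡.refl)
  firstIndex-sound {suc n} f {suc i} | no _     = firstIndex-sound (f ∘ suc) {i}

  firstIndex-≤ : ∀ {n} (f : Fin (suc n) → A) i → firstIndex f (f i) Fin.≤ i
  firstIndex-≤ {zero}  f zero = ℕ.z≤n
  firstIndex-≤ {suc n} f i with f zero ≟ f i
  ... | yes _ = ℕ.z≤n
  firstIndex-≤ {suc n} f zero    | no f0≢f0 = ⊥-elim (f0≢f0 ≡.refl)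
  firstIndex-≤ {suc n} f (suc i) | no _     = ℕ.s≤s (firstIndex-≤ (f ∘ suc) i)

  firstIndex-idem : ∀ {n} (f : Fin (suc n) → A) {i} → firstIndex f (f (firstIndex f (f i))) ≡ firstIndex f (f i)
  firstIndex-idem f = ≡.cong (firstIndex f) (firstIndex-sound f)

  firstIndex-≡⇔ : ∀ {n} (f : Fin (suc n) → A) {i j} → firstIndex f (f i) ≡ firstIndex f (f j) ⇔ f i ≡ f j
  firstIndex-≡⇔ f {i} {j} = mk⇔
    (λ eq → ≡.trans (≡.sym (firstIndex-sound f)) (≡.trans (≡.cong f eq) (firstIndex-sound f)))
    (≡.cong (firstIndex f))

nextLeaders : ℕ → ℕ → List ℕ → List ℕ
nextLeaders pos x ls with x ℕ.≟ pos
... | yes _ = pos ∷ ls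
... | no _  = ls

-- Entry k of a leader vector is the first position of the block of position k: either k itself
-- or an earlier entry.  ForAllLeaderVectors n pos ls P states P for all continuations of length n
-- of a prefix of length pos whose blocks start at the positions ls.
ForAllLeaderVectors : ∀ n → ℕ → List ℕ → (Vec ℕ n → Set) → Set
ForAllLeaderVectors zero    pos ls P = P []
ForAllLeaderVectors (suc n) pos ls P =
  All (λ x → ForAllLeaderVectors n (suc pos) (nextLeaders pos x ls) (P ∘ (x ∷_))) (pos ∷ ls)

forAllLeaderVectors? : ∀ n pos ls {P : Vec ℕ n → Set} → (∀ xs → Dec (P xs)) → Dec (ForAllLeaderVectors n pos ls P)
forAllLeaderVectors? zero    pos ls P? = P? []
forAllLeaderVectors? (suc n) pos ls P? =
  All.all? (λ x → forAllLeaderVectors? n (suc pos) (nextLeaders pos x ls) (P? ∘ (x ∷_))) (pos ∷ ls)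

IsLeaderVector : ∀ {n} → ℕ → List ℕ → (Fin n → ℕ) → Set
IsLeaderVector pos ls g = ∀ k → g k ≡ pos ℕ.+ toℕ k ⊎ g k ∈ ls ⊎ ∃ λ j → j Fin.< k × g j ≡ g k

private
  ∈-nextLeaders⁺ : ∀ pos x {y ls} → y ∈ ls → y ∈ nextLeaders pos x ls
  ∈-nextLeaders⁺ pos x y∈ls with x ℕ.≟ pos
  ... | yes _ = there y∈ls
  ... | no _  = y∈ls

  ∈-nextLeaders : ∀ pos {x ls} → x ∈ pos ∷ ls → x ∈ nextLeaders pos x ls
  ∈-nextLeaders pos {x} x∈ with x ℕ.≟ pos | x∈
  ... | yes x≡pos | _         = here x≡pos
  ... | no x≢pos  | here x≡pos = ⊥-elim (x≢pos x≡pos)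
  ... | no _      | there x∈ls = x∈ls

forAllLeaderVectors-tabulate : ∀ {n pos ls} {P : Vec ℕ n → Set} (g : Fin n → ℕ) →
  IsLeaderVector pos ls g → ForAllLeaderVectors n pos ls P → P (tabulate g)
forAllLeaderVectors-tabulate {zero}          g _   all = all
forAllLeaderVectors-tabulate {suc n} {pos} {ls} g leader all =
  forAllLeaderVectors-tabulate (g ∘ suc) leader-tail (All.lookup all g₀∈)
  where
  g₀∈ : g zero ∈ pos ∷ ls
  g₀∈ with leader zero
  ... | inj₁ g₀≡pos+0       = here (≡.trans g₀≡pos+0 (ℕ.+-identityʳ pos))
  ... | inj₂ (inj₁ g₀∈ls)   = there g₀∈ls
  ... | inj₂ (inj₂ (_ , () , _))
  leader-tail : IsLeaderVector (suc pos) (nextLeaders pos (g zero) ls) (g ∘ suc)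
  leader-tail k with leader (suc k)
  ... | inj₁ eq                             = inj₁ (≡.trans eq (ℕ.+-suc pos (toℕ k)))
  ... | inj₂ (inj₁ g∈ls)                  = inj₂ (inj₁ (∈-nextLeaders⁺ pos (g zero) g∈ls))
  ... | inj₂ (inj₂ (zero , _ , g₀≡g))       =
    inj₂ (inj₁ (≡.subst (_∈ nextLeaders pos (g zero) ls) g₀≡g (∈-nextLeaders pos g₀∈)))
  ... | inj₂ (inj₂ (suc j , ℕ.s≤s j<k , eq))  = inj₂ (inj₂ (j , j<k , eq))

-- the block of C_{k+2} is labelled by its least element, as in `listed`
labelling : Vec ℕ 8 → Vec ℕ 9
labelling xs = 0 ∷ Vec.map (2 ℕ.+_) xs

leader : Partition → Fin 8 → Fin 8
leader τ k = firstIndex Fin._≟_ τ (τ k)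

leaderVector : Partition → Vec ℕ 8
leaderVector τ = tabulate (toℕ ∘ leader τ)

module _ (τ : Partition) where
  leaderVector-isLeaderVector : IsLeaderVector 0 [] (toℕ ∘ leader τ)
  leaderVector-isLeaderVector k with leader τ k Fin.≟ k
  ... | yes leader≡k = inj₁ (≡.cong toℕ leader≡k)
  ... | no  leader≢k = inj₂ (inj₂ (leader τ k , Fin.≤∧≢⇒< (firstIndex-≤ Fin._≟_ τ k) leader≢k
                                  , ≡.cong toℕ (firstIndex-idem Fin._≟_ τ)))

  lookup-labelling : ∀ k → lookup (labelling (leaderVector τ)) (suc k) ≡ 2 ℕ.+ toℕ (leader τ k)
  lookup-labelling k = ≡.trans (Vecₚ.lookup-map k (2 ℕ.+_) (leaderVector τ))
                               (≡.cong (2 ℕ.+_) (Vecₚ.lookup∘tabulate (toℕ ∘ leader τ) k))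

  private
    0≢2+ : ∀ {n} → 0 ≢ 2 ℕ.+ n
    0≢2+ ()

  leaderVector-samePartition : SamePartition τ (labelling (leaderVector τ))
  leaderVector-samePartition zero    zero    = mk⇔ (λ _ → ≡.refl) (λ _ → ≡.refl)
  leaderVector-samePartition zero    (suc b) =
    mk⇔ (λ ()) (λ eq → ⊥-elim (0≢2+ (≡.trans eq (lookup-labelling b))))
  leaderVector-samePartition (suc a) zero    =
    mk⇔ (λ ()) (λ eq → ⊥-elim (0≢2+ (≡.trans (≡.sym eq) (lookup-labelling a))))
  leaderVector-samePartition (suc a) (suc b) = mk⇔
    (λ τa≡τb → ≡.trans (lookup-labelling a) (≡.trans
      (≡.cong ((2 ℕ.+_) ∘ toℕ) (Equivalence.from (firstIndex-≡⇔ Fin._≟_ τ) (Fin.suc-injective τa≡τb)))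
      (≡.sym (lookup-labelling b))))
    (λ La≡Lb → ≡.cong suc (Equivalence.to (firstIndex-≡⇔ Fin._≟_ τ) (Fin.toℕ-injective
      (ℕ.+-cancelˡ-≡ 2 _ _ (≡.trans (≡.sym (lookup-labelling a)) (≡.trans La≡Lb (lookup-labelling b)))))))

pattern i₁ = suc zero
pattern i₂ = suc (suc zero)

module TableAlgebraProperties {F : RealField} (A : TableAlgebra F) where
  open RealField F
  open CommutativeRing commutativeRing using (refl; sym; trans; *-congˡ; *-congʳ; zeroʳ)
  open TableAlgebra A
  open SumProperties commutativeRing
  open RealFieldProperties F using (ι-suc≉0; *-cancelʳ)
  open import Relation.Binary.Reasoning.Setoid (CommutativeRing.setoid commutativeRing)

  δ≉0 : ∀ i → ¬ (δ i ≈ 0#)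
  δ≉0 i δi≈0 with valency-int i
  ... | n , δi≈ι = ι-suc≉0 n (trans (sym δi≈ι) δi≈0)

  -- compare the coefficients of A₀ in (A_i A_j) A_h = A_i (A_j A_h)
  c-δ-rotate : ∀ i j h → c i j h * δ h ≈ c j h i * δ i
  c-δ-rotate i j h = begin
    c i j h * δ h
      ≈⟨ ∑-single (λ m → c i j m * c m h zero) h (λ m m≢h → vanish (off-diag m h m≢h)) ⟨
    Σ3 F (λ m → c i j m * c m h zero)
      ≈⟨ assoc i j h zero ⟩
    Σ3 F (λ m → c j h m * c i m zero)
      ≈⟨ ∑-single (λ m → c j h m * c i m zero) i (λ m m≢i → vanish (off-diag i m (m≢i ∘ ≡.sym))) ⟩
    c j h i * δ i ∎
    where
    vanish : ∀ {x y} → y ≈ 0# → x * y ≈ 0#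
    vanish y≈0 = trans (*-congˡ y≈0) (zeroʳ _)

  c-δ-swap : ∀ i j h → c i j h * δ h ≈ c i h j * δ j
  c-δ-swap i j h = trans (c-δ-rotate i j h) (trans (*-congʳ (comm j h i)) (sym (c-δ-rotate i h j)))

  rowSum : ∀ i h → Σ3 F (λ j → c i j h) ≈ δ i
  rowSum i h = *-cancelʳ (δ≉0 h) (begin
    Σ3 F (λ j → c i j h) * δ h  ≈⟨ ∑-distribʳ (λ j → c i j h) (δ h) ⟩
    Σ3 F (λ j → c i j h * δ h)  ≈⟨ ∑-cong (λ j → c-δ-swap i j h) ⟩
    Σ3 F (λ j → c i h j * δ j)  ≈⟨ valency-hom i h ⟨
    δ i * δ h                   ∎)

tensorSquare : ∀ {a} {A : Set a} → (A → A → A) → (Fin 3 → Fin 3 → Fin 3 → A) → Fin 9 → Fin 9 → Fin 9 → A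
tensorSquare _⊗_ c a b e =
  c (proj₁ (tensorIdx a)) (proj₁ (tensorIdx b)) (proj₁ (tensorIdx e)) ⊗
  c (proj₂ (tensorIdx a)) (proj₂ (tensorIdx b)) (proj₂ (tensorIdx e))

module StructurePolynomials (F : RealField) where
  open RealField F using (Carrier; _≈_; _+_; -_; commutativeRing)
  open CommutativeRing commutativeRing using (_-_; refl; sym; trans; +-cong; -‿cong; *-cong; +-identityʳ)
  open IntegerCoefficients commutativeRing

  kroneckerPoly : Fin 3 → Fin 3 → Polynomial 4
  kroneckerPoly j h = con (if does (j Fin.≟ h) then + 1 else + 0)

  -- the variables stand for δ(A₁), δ(A₂), λ₁₂₁ and λ₁₂₂
  mixedPoly : Fin 3 → Polynomial 4
  mixedPoly zero = con (+ 0)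
  mixedPoly i₁   = var (suc (suc zero))
  mixedPoly i₂   = var (suc (suc (suc zero)))

  structurePoly : Fin 3 → Fin 3 → Fin 3 → Polynomial 4
  structurePoly zero    j    h       = kroneckerPoly j h
  structurePoly (suc i) zero h       = kroneckerPoly (suc i) h
  structurePoly i₁      i₁   zero    = var zero
  structurePoly i₁      i₁   (suc h) = (var zero :- kroneckerPoly i₁ (suc h)) :- mixedPoly (suc h)
  structurePoly i₁      i₂   h       = mixedPoly h
  structurePoly i₂      i₁   h       = mixedPoly h
  structurePoly i₂      i₂   zero    = var (suc zero)
  structurePoly i₂      i₂   (suc h) = (var (suc zero) :- kroneckerPoly i₂ (suc h)) :- mixedPoly (suc h)

  tensorPoly : Fin 9 → Fin 9 → Fin 9 → Polynomial 4
  tensorPoly = tensorSquare _:*_ structurePoly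

  private
    solve-middle : ∀ {x y z w x′ z′} → x + (y + z) ≈ w → x ≈ x′ → z ≈ z′ → y ≈ (w - x′) - z′
    solve-middle {x} {y} {z} sum x≈x′ z≈z′ =
      trans (solve 3 (λ x y z → y := ((x :+ (y :+ z)) :- x) :- z) refl x y z)
            (+-cong (+-cong sum (-‿cong x≈x′)) (-‿cong z≈z′))

    solve-last : ∀ {x y z w x′ y′} → x + (y + z) ≈ w → x ≈ x′ → y ≈ y′ → z ≈ (w - x′) - y′
    solve-last {x} {y} {z} sum x≈x′ y≈y′ =
      trans (solve 3 (λ x y z → z := ((x :+ (y :+ z)) :- x) :- y) refl x y z)
            (+-cong (+-cong sum (-‿cong x≈x′)) (-‿cong y≈y′))

  module _ (A : TableAlgebra F) where
    open TableAlgebra A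
    open TableAlgebraProperties A using (rowSum)

    parameters : Vec Carrier 4
    parameters = δ i₁ ∷ δ i₂ ∷ c i₁ i₂ i₁ ∷ c i₁ i₂ i₂ ∷ []

    kron≈kroneckerPoly : ∀ j h → kron F j h ≈ ⟦ kroneckerPoly j h ⟧ parameters
    kron≈kroneckerPoly j h with does (j Fin.≟ h)
    ... | true  = sym (+-identityʳ _)
    ... | false = refl

    c₁₂≈mixedPoly : ∀ h → c i₁ i₂ h ≈ ⟦ mixedPoly h ⟧ parameters
    c₁₂≈mixedPoly zero = off-diag i₁ i₂ λ ()
    c₁₂≈mixedPoly i₁   = refl
    c₁₂≈mixedPoly i₂   = refl

    c≈kroneckerPoly : ∀ i h → c i zero h ≈ ⟦ kroneckerPoly i h ⟧ parameters
    c≈kroneckerPoly i h = trans (comm i zero h) (trans (unit i h) (kron≈kroneckerPoly i h))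

    c≈structurePoly : ∀ i j h → c i j h ≈ ⟦ structurePoly i j h ⟧ parameters
    c≈structurePoly zero    j    h       = trans (unit j h) (kron≈kroneckerPoly j h)
    c≈structurePoly (suc i) zero h       = c≈kroneckerPoly (suc i) h
    c≈structurePoly i₁      i₁   zero    = refl
    c≈structurePoly i₁      i₁   (suc h) =
      solve-middle (rowSum i₁ (suc h)) (c≈kroneckerPoly i₁ (suc h)) (c₁₂≈mixedPoly (suc h))
    c≈structurePoly i₁      i₂   h       = c₁₂≈mixedPoly h
    c≈structurePoly i₂      i₁   h       = trans (comm i₂ i₁ h) (c₁₂≈mixedPoly h)
    c≈structurePoly i₂      i₂   zero    = refl
    c≈structurePoly i₂      i₂   (suc h) =
      solve-last (rowSum i₂ (suc h)) (c≈kroneckerPoly i₂ (suc h))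
                 (trans (comm i₂ i₁ (suc h)) (c₁₂≈mixedPoly (suc h)))

    tc≈tensorPoly : ∀ a b e → tc A a b e ≈ ⟦ tensorPoly a b e ⟧ parameters
    tc≈tensorPoly a b e = *-cong (c≈structurePoly _ _ _) (c≈structurePoly _ _ _)

blockProduct : ∀ {a} {A : Set a} → (A → A → A) → A →
               (Fin 9 → Bool) → (Fin 9 → Bool) → (Fin 9 → Fin 9 → A) → A
blockProduct _⊕_ o P Q t = ∑ _⊕_ (λ p → if P p then ∑ _⊕_ (λ q → if Q q then t p q else o) else o)

inBlock : ∀ {B : Set} → DecidableEquality B → (Fin 9 → B) → B → Fin 9 → Bool
inBlock _≟_ π l p = does (π p ≟ l)

sameBlock : Vec ℕ 9 → ℕ → Fin 9 → Bool
sameBlock L = inBlock ℕ._≟_ (lookup L)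

representative : Vec ℕ 9 → Fin 9 → Fin 9
representative L e = firstIndex ℕ._≟_ (lookup L) (lookup L e)

module BlockProducts (F : RealField) where
  open RealField F
  open CommutativeRing commutativeRing
    using (refl; sym; trans; reflexive; *-congʳ; *-identityˡ; zeroˡ)
  open SumProperties commutativeRing

  private
    if-cong : ∀ {b b′ x y} → b ≡ b′ → x ≈ y → (if b then x else 0#) ≈ (if b′ then y else 0#)
    if-cong {true}  ≡.refl x≈y = x≈y
    if-cong {false} ≡.refl _   = refl

    indicator-* : ∀ b x → (if b then 1# else 0#) * x ≈ (if b then x else 0#)
    indicator-* true  x = *-identityˡ x
    indicator-* false x = zeroˡ x

  blockProduct-cong : ∀ {P P′ Q Q′ : Fin 9 → Bool} {t t′ : Fin 9 → Fin 9 → Carrier} →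
    (∀ p → P p ≡ P′ p) → (∀ q → Q q ≡ Q′ q) → (∀ p q → t p q ≈ t′ p q) →
    blockProduct _+_ 0# P Q t ≈ blockProduct _+_ 0# P′ Q′ t′
  blockProduct-cong P≡P′ Q≡Q′ t≈t′ =
    ∑-cong λ p → if-cong (P≡P′ p) (∑-cong λ q → if-cong (Q≡Q′ q) (t≈t′ p q))

  blockProduct-homo : ∀ {a} {A : Set a} (_⊕_ : A → A → A) (o : A) (h : A → Carrier) →
    h o ≈ 0# → (∀ x y → h (x ⊕ y) ≈ h x + h y) →
    ∀ P Q t → h (blockProduct _⊕_ o P Q t) ≈ blockProduct _+_ 0# P Q (λ p q → h (t p q))
  blockProduct-homo {A = A} _⊕_ o h ho≈0 homo P Q t =
    trans (∑-homo _⊕_ h homo row) (∑-cong λ p →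
      if-homo (P p) {∑ _⊕_ (entry p)} (trans (∑-homo _⊕_ h homo (entry p)) (∑-cong λ q → if-homo (Q q) {t p q} refl)))
    where
    entry : Fin 9 → Fin 9 → A
    entry p q = if Q q then t p q else o
    row : Fin 9 → A
    row p = if P p then ∑ _⊕_ (entry p) else o
    if-homo : ∀ b {x y} → h x ≈ y → h (if b then x else o) ≈ (if b then y else 0#)
    if-homo true  hx≈y = hx≈y
    if-homo false _    = ho≈0

  tensorSquare-homo : ∀ {a} {A : Set a} (_⊗_ : A → A → A) (h : A → Carrier) →
    (∀ x y → h (x ⊗ y) ≈ h x * h y) →
    ∀ c a b e → h (tensorSquare _⊗_ c a b e) ≈ tensorSquare _*_ (λ i j k → h (c i j k)) a b e
  tensorSquare-homo _⊗_ h homo c a b e = homo _ _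

  mul-blockSum : ∀ (A : TableAlgebra F) τ a b e → mul A τ (blockSum A τ a) (blockSum A τ b) e ≈
    blockProduct _+_ 0# (inBlock Fin._≟_ (label τ) (label τ a)) (inBlock Fin._≟_ (label τ) (label τ b))
                        (λ p q → tc A p q e)
  mul-blockSum A τ a b e = ∑-cong λ p → row (inBlock Fin._≟_ (label τ) (label τ a) p) p
    where
    Q = inBlock Fin._≟_ (label τ) (label τ b)
    row : ∀ b p → ∑ _+_ (λ q → ((if b then 1# else 0#) * (if Q q then 1# else 0#)) * tc A p q e) ≈
                  (if b then ∑ _+_ (λ q → if Q q then tc A p q e else 0#) else 0#)
    row true  p = ∑-cong λ q → trans (*-congʳ (*-identityˡ (if Q q then 1# else 0#))) (indicator-* (Q q) (tc A p q e))
    row false p =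
      trans (∑-cong λ q → trans (*-congʳ (zeroˡ (if Q q then 1# else 0#))) (zeroˡ (tc A p q e))) (∑-zero {8})

  InSpan⇒blockConstant : ∀ (A : TableAlgebra F) τ {v : Fin 9 → Carrier} → InSpan A τ v →
    ∀ {e f} → label τ e ≡ label τ f → v e ≈ v f
  InSpan⇒blockConstant A τ (w , v≈w) {e} {f} eq = trans (v≈w e) (trans (reflexive (≡.cong w eq)) (sym (v≈w f)))

  mul≈blockProduct : ∀ (A : TableAlgebra F) τ L → SamePartition τ L → ∀ a b e →
    mul A τ (blockSum A τ a) (blockSum A τ b) e ≈
    blockProduct _+_ 0# (sameBlock L (lookup L a)) (sameBlock L (lookup L b)) (λ p q → tc A p q e)
  mul≈blockProduct A τ L same a b e =
    trans (mul-blockSum A τ a b e) (blockProduct-cong {t = λ p q → tc A p q e} (blocks≡ a) (blocks≡ b) (λ _ _ → refl))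
    where
    blocks≡ : ∀ a p → inBlock Fin._≟_ (label τ) (label τ a) p ≡ sameBlock L (lookup L a) p
    blocks≡ a p = does-⇔ (same p a) (label τ p Fin.≟ label τ a) (lookup L p ℕ.≟ lookup L a)

  blockConstant⇒InSpan : ∀ (A : TableAlgebra F) τ (v : Fin 9 → Carrier) →
    (∀ e f → label τ e ≡ label τ f → v e ≈ v f) → InSpan A τ v
  blockConstant⇒InSpan A τ v const =
    (λ l → v (firstIndex Fin._≟_ (label τ) l)) , λ e → const e _ (≡.sym (firstIndex-sound Fin._≟_ (label τ)))

record NaturalTableAlgebra : Set where
  field
    c           : Fin 3 → Fin 3 → Fin 3 → ℕ
    unit        : ∀ j h → c zero j h ≡ (if does (j Fin.≟ h) then 1 else 0)
    comm        : ∀ i j h → c i j h ≡ c j i h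
    assoc       : ∀ i j h t → ∑ ℕ._+_ (λ m → c i j m ℕ.* c m h t) ≡ ∑ ℕ._+_ (λ m → c j h m ℕ.* c i m t)
    off-diag    : ∀ i j → i ≢ j → c i j zero ≡ 0
    valency-≢0  : ∀ i → c i i zero ≢ 0
    valency-hom : ∀ i j → c i i zero ℕ.* c j j zero ≡ ∑ ℕ._+_ (λ h → c i j h ℕ.* c h h zero)

module _ (F : RealField) where
  open RealField F
  open CommutativeRing commutativeRing using (refl; sym; trans; reflexive; +-identityʳ)
  open SumProperties commutativeRing
  open RealFieldProperties F using (ι-+; ι-*; 0≤ι)

  ι-∑-* : ∀ (f g : Fin 3 → ℕ) →
          Σ3 F (λ m → ι F (f m) * ι F (g m)) ≈ ι F (∑ ℕ._+_ (λ m → f m ℕ.* g m))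
  ι-∑-* f g = trans (∑-cong λ m → sym (ι-* (f m) (g m))) (sym (∑-homo ℕ._+_ (ι F) ι-+ (λ m → f m ℕ.* g m)))

  toTableAlgebra : NaturalTableAlgebra → TableAlgebra F
  toTableAlgebra T = record
    { c           = λ i j h → ι F (c i j h)
    ; unit        = λ j h → trans (reflexive (≡.cong (ι F) (unit j h))) (ι-indicator (does (j Fin.≟ h)))
    ; comm        = λ i j h → reflexive (≡.cong (ι F) (comm i j h))
    ; assoc       = λ i j h t → trans (ι-∑-* (c i j) (λ m → c m h t))
                      (trans (reflexive (≡.cong (ι F) (assoc i j h t))) (sym (ι-∑-* (c j h) (λ m → c i m t))))
    ; nonneg      = λ i j h → 0≤ι (c i j h)
    ; off-diag    = λ i j i≢j → reflexive (≡.cong (ι F) (off-diag i j i≢j))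
    ; valency-int = λ i → valency-suc (c i i zero) (valency-≢0 i)
    ; valency-hom = λ i j → trans (sym (ι-* (c i i zero) (c j j zero)))
                      (trans (reflexive (≡.cong (ι F) (valency-hom i j))) (sym (ι-∑-* (c i j) (λ h → c h h zero))))
    }
    where
    open NaturalTableAlgebra T
    ι-indicator : ∀ b → ι F (if b then 1 else 0) ≈ (if b then 1# else 0#)
    ι-indicator true  = +-identityʳ 1#
    ι-indicator false = refl
    valency-suc : ∀ m → m ≢ 0 → ∃ λ n → ι F m ≈ ι F (suc n)
    valency-suc zero    m≢0 = ⊥-elim (m≢0 ≡.refl)
    valency-suc (suc n) _   = n , refl

-- A₁ is the adjacency matrix of the Petersen graph: valency 3, λ = 0, μ = 1
petersenConstants : Fin 3 → Fin 3 → Vec ℕ 3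
petersenConstants zero zero = 1 ∷ 0 ∷ 0 ∷ []
petersenConstants zero i₁   = 0 ∷ 1 ∷ 0 ∷ []
petersenConstants zero i₂   = 0 ∷ 0 ∷ 1 ∷ []
petersenConstants i₁   zero = 0 ∷ 1 ∷ 0 ∷ []
petersenConstants i₁   i₁   = 3 ∷ 0 ∷ 1 ∷ []
petersenConstants i₁   i₂   = 0 ∷ 2 ∷ 2 ∷ []
petersenConstants i₂   zero = 0 ∷ 0 ∷ 1 ∷ []
petersenConstants i₂   i₁   = 0 ∷ 2 ∷ 2 ∷ []
petersenConstants i₂   i₂   = 6 ∷ 4 ∷ 3 ∷ []

petersen : NaturalTableAlgebra
petersen = record
  { c           = c
  ; unit        = from-yes (Fin.all? λ j → Fin.all? λ h → c zero j h ℕ.≟ (if does (j Fin.≟ h) then 1 else 0))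
  ; comm        = from-yes (Fin.all? λ i → Fin.all? λ j → Fin.all? λ h → c i j h ℕ.≟ c j i h)
  ; assoc       = from-yes (Fin.all? λ i → Fin.all? λ j → Fin.all? λ h → Fin.all? λ t →
                    ∑ ℕ._+_ (λ m → c i j m ℕ.* c m h t) ℕ.≟ ∑ ℕ._+_ (λ m → c j h m ℕ.* c i m t))
  ; off-diag    = from-yes (Fin.all? λ i → Fin.all? λ j → ¬? (i Fin.≟ j) →-dec (c i j zero ℕ.≟ 0))
  ; valency-≢0  = from-yes (Fin.all? λ i → ¬? (c i i zero ℕ.≟ 0))
  ; valency-hom = from-yes (Fin.all? λ i → Fin.all? λ j →
                    c i i zero ℕ.* c j j zero ℕ.≟ ∑ ℕ._+_ (λ h → c i j h ℕ.* c h h zero))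
  }
  where
  c : Fin 3 → Fin 3 → Fin 3 → ℕ
  c i j h = lookup (petersenConstants i j) h

petersenTensor : Fin 9 → Fin 9 → Fin 9 → ℕ
petersenTensor = tensorSquare ℕ._*_ (NaturalTableAlgebra.c petersen)

petersenProduct : Vec ℕ 9 → Fin 9 → Fin 9 → Fin 9 → ℕ
petersenProduct L a b e =
  blockProduct ℕ._+_ 0 (sameBlock L (lookup L a)) (sameBlock L (lookup L b)) (λ p q → petersenTensor p q e)

-- C₆C₆, C₇C₈ and C₂C₅, i.e. A₂₁A₂₁, A₀₂A₁₂ and A₁₀A₁₁
petersenTests : List (Fin 9 × Fin 9)
petersenTests = (Fin.# 5 , Fin.# 5) ∷ (Fin.# 6 , Fin.# 7) ∷ (Fin.# 1 , Fin.# 4) ∷ []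

PassesPetersenTests : Vec ℕ 9 → Set
PassesPetersenTests L =
  All (λ (a , b) → ∀ e → petersenProduct L a b e ≡ petersenProduct L a b (representative L e)) petersenTests

passesPetersenTests? : ∀ L → Dec (PassesPetersenTests L)
passesPetersenTests? L = All.all? (λ (a , b) → Fin.all? λ e →
  petersenProduct L a b e ℕ.≟ petersenProduct L a b (representative L e)) petersenTests

ListedIfPassesPetersenTests : Vec ℕ 8 → Set
ListedIfPassesPetersenTests xs = PassesPetersenTests (labelling xs) → labelling xs ∈ listed

onlyListedPassPetersenTests : ForAllLeaderVectors 8 0 [] ListedIfPassesPetersenTests
onlyListedPassPetersenTests = from-yes (forAllLeaderVectors? 8 0 [] λ xs →
  passesPetersenTests? (labelling xs) →-dec (labelling xs ∈? listed))

module SymbolicFusion (F : RealField) where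
  open RealField F
  open CommutativeRing commutativeRing using (sym; trans)
  open IntegerCoefficients commutativeRing
  open StructurePolynomials F

  blockPoly : Vec ℕ 9 → ℕ → ℕ → Fin 9 → Polynomial 4
  blockPoly L la lb e = blockProduct _:+_ (con (+ 0)) (sameBlock L la) (sameBlock L lb) (λ p q → tensorPoly p q e)

  SameNormalForm : Polynomial 4 → Polynomial 4 → Set
  SameNormalForm p q = T (is-just (normalise p ≟N normalise q))

  sameNormalForm-sound : ∀ p q → SameNormalForm p q → ∀ ρ → ⟦ p ⟧ ρ ≈ ⟦ q ⟧ ρ
  sameNormalForm-sound p q same ρ = sound (normalise p ≟N normalise q) same
    where
    sound : (eq? : Maybe (normalise p ≈N normalise q)) → T (is-just eq?) → ⟦ p ⟧ ρ ≈ ⟦ q ⟧ ρ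
    sound (just eq) _ = trans (sym (correct p ρ)) (trans (⟦ eq ⟧N-cong ρ) (correct q ρ))

  FusionIdentities : Vec ℕ 9 → Set
  FusionIdentities L = ∀ a b → representative L a ≡ a → representative L b ≡ b → ∀ e →
    SameNormalForm (blockPoly L (lookup L a) (lookup L b) e) (blockPoly L (lookup L a) (lookup L b) (representative L e))

  listedFusionIdentities : All FusionIdentities listed
  listedFusionIdentities = from-yes (All.all? (λ L → Fin.all? λ a → Fin.all? λ b →
    (representative L a Fin.≟ a) →-dec (representative L b Fin.≟ b) →-dec Fin.all? λ e →
    T? (is-just (normalise (blockPoly L (lookup L a) (lookup L b) e) ≟N
                 normalise (blockPoly L (lookup L a) (lookup L b) (representative L e))))) listed)


module Forward (F : RealField) where
  open RealField F
  open CommutativeRing commutativeRing using (refl; sym; trans)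
  open RealFieldProperties F using (ι-+; ι-*; ι-injective)
  open BlockProducts F

  petersenAlgebra : TableAlgebra F
  petersenAlgebra = toTableAlgebra F petersen

  ι-petersenProduct : ∀ τ L → SamePartition τ L → ∀ a b e →
    ι F (petersenProduct L a b e) ≈ mul petersenAlgebra τ (blockSum petersenAlgebra τ a) (blockSum petersenAlgebra τ b) e
  ι-petersenProduct τ L same a b e =
    trans (blockProduct-homo ℕ._+_ 0 (ι F) refl ι-+ P Q (λ p q → petersenTensor p q e))
          (trans (blockProduct-cong {P = P} {Q = Q} (λ _ → ≡.refl) (λ _ → ≡.refl)
                   (λ p q → tensorSquare-homo ℕ._*_ (ι F) ι-* (NaturalTableAlgebra.c petersen) p q e))
                 (sym (mul≈blockProduct petersenAlgebra τ L same a b e)))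
    where
    P = sameBlock L (lookup L a)
    Q = sameBlock L (lookup L b)

  petersenFusion⇒listed : ∀ τ → GivesFusion petersenAlgebra τ → IsListed τ
  petersenFusion⇒listed τ fusion = Any.map (λ L≡ → ≡.subst (SamePartition τ) L≡ same) (survives passes)
    where
    L = labelling (leaderVector τ)
    same = leaderVector-samePartition τ
    survives : PassesPetersenTests L → L ∈ listed
    survives = forAllLeaderVectors-tabulate {P = ListedIfPassesPetersenTests} (toℕ ∘ leader τ)
                 (leaderVector-isLeaderVector τ) onlyListedPassPetersenTests
    passes : PassesPetersenTests L
    passes = All.tabulate λ {(a , b)} _ e → ι-injective (trans (ι-petersenProduct τ L same a b e)
      (trans (InSpan⇒blockConstant petersenAlgebra τ (fusion a b)
                (Equivalence.from (same e (representative L e)) (≡.sym (firstIndex-sound ℕ._≟_ (lookup L) {e}))))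
             (sym (ι-petersenProduct τ L same a b (representative L e)))))

module Backward (F : RealField) where
  open RealField F
  open CommutativeRing commutativeRing using (refl; sym; trans)
  open IntegerCoefficients commutativeRing
  open StructurePolynomials F
  open BlockProducts F
  open SymbolicFusion F

  mul≈⟦blockPoly⟧ : ∀ A τ L → SamePartition τ L → ∀ a b e →
    mul A τ (blockSum A τ a) (blockSum A τ b) e ≈ ⟦ blockPoly L (lookup L a) (lookup L b) e ⟧ (parameters A)
  mul≈⟦blockPoly⟧ A τ L same a b e =
    trans (mul≈blockProduct A τ L same a b e)
          (trans (blockProduct-cong {P = P} {Q = Q} (λ _ → ≡.refl) (λ _ → ≡.refl) (λ p q → tc≈tensorPoly A p q e))
                 (sym (blockProduct-homo _:+_ (con (+ 0)) (λ p → ⟦ p ⟧ (parameters A)) refl (λ _ _ → refl) P Q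
                        (λ p q → tensorPoly p q e))))
    where
    P = sameBlock L (lookup L a)
    Q = sameBlock L (lookup L b)

  fusionIdentities⇒fusion : ∀ τ L → SamePartition τ L → FusionIdentities L → ∀ A → GivesFusion A τ
  fusionIdentities⇒fusion τ L same identities A a b = blockConstant⇒InSpan A τ v λ e f le≡lf → begin
    v e                    ≈⟨ atRepresentative e ⟩
    v (representative L e) ≡⟨ ≡.cong (v ∘ firstIndex ℕ._≟_ (lookup L)) (Equivalence.to (same e f) le≡lf) ⟩
    v (representative L f) ≈⟨ atRepresentative f ⟨
    v f                    ∎
    where
    open import Relation.Binary.Reasoning.Setoid (CommutativeRing.setoid commutativeRing)
    v = mul A τ (blockSum A τ a) (blockSum A τ b)
    ρ = parameters A
    a′ = representative L a
    b′ = representative L b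
    La′≡La : lookup L a′ ≡ lookup L a
    La′≡La = firstIndex-sound ℕ._≟_ (lookup L)
    Lb′≡Lb : lookup L b′ ≡ lookup L b
    Lb′≡Lb = firstIndex-sound ℕ._≟_ (lookup L)
    polyAt : ℕ → ℕ → Fin 9 → Carrier
    polyAt la lb e = ⟦ blockPoly L la lb e ⟧ ρ
    identity : ∀ e → polyAt (lookup L a′) (lookup L b′) e ≈ polyAt (lookup L a′) (lookup L b′) (representative L e)
    identity e = sameNormalForm-sound (blockPoly L (lookup L a′) (lookup L b′) e)
                   (blockPoly L (lookup L a′) (lookup L b′) (representative L e))
                   (identities a′ b′ (firstIndex-idem ℕ._≟_ (lookup L)) (firstIndex-idem ℕ._≟_ (lookup L)) e) ρ
    atRepresentative : ∀ e → v e ≈ v (representative L e)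
    atRepresentative e = begin
      v e                                            ≈⟨ mul≈⟦blockPoly⟧ A τ L same a b e ⟩
      polyAt (lookup L a) (lookup L b) e             ≡⟨ ≡.cong₂ (λ la lb → polyAt la lb e) La′≡La Lb′≡Lb ⟨
      polyAt (lookup L a′) (lookup L b′) e           ≈⟨ identity e ⟩
      polyAt (lookup L a′) (lookup L b′) e′          ≡⟨ ≡.cong₂ (λ la lb → polyAt la lb e′) La′≡La Lb′≡Lb ⟩
      polyAt (lookup L a) (lookup L b) e′            ≈⟨ mul≈⟦blockPoly⟧ A τ L same a b e′ ⟨
      v e′                                           ∎
      where e′ = representative L e

  listed⇒fusion : ∀ τ → IsListed τ → ∀ A → GivesFusion A τ
  listed⇒fusion τ listedτ = All.lookupWith (λ {L} identities same → fusionIdentities⇒fusion τ L same identities)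
                                          listedFusionIdentities listedτ

lemma4p1 : (F : RealField) (τ : Partition) →
    ((∀ (A : TableAlgebra F) → GivesFusion A τ) ⇔ IsListed τ)
lemma4p1 F τ = mk⇔ (λ fusion → petersenFusion⇒listed τ (fusion petersenAlgebra)) (listed⇒fusion τ)
  where
  open Forward F
  open Backward F
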